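{- Every co-Heyting algebra existentially closed in the variety $\mathcal V_2$ satisfies the density axiom D2 and the splitting axiom S2.
   Context: A co-Heyting algebra is a bounded distributive lattice $(L,\mathbf{0},\mathbf{1},\vee,\wedge)$ with a binary operation $-$ such that $a-b$ is the least $c\in L$ with $a\le b\vee c$; it is a structure in the language $\{\mathbf 0,\mathbf 1,\vee,\wedge,-\}$ and extensions are taken in this language. For $a,b\in L$ write $b\ll a$ iff $a-b=a$ and $b\le a$. $\mathcal V_2$ is the variety of co-Heyting algebras satisfying the identity $(\mathbf 1-x)\wedge(\mathbf 1-(\mathbf 1-x))=\mathbf 0$. An algebra $L\in\mathcal V_2$ is existentially closed in $\mathcal V_2$ if every existential formula with parameters in $L$ true in some extension of $L$ in $\mathcal V_2$ is true in $L$. Axiom D2: for all $a,c$ with $c\ll a$ and $a\neq\mathbf 0$ there is $b\neq\mathbf 0$ with $c\ll b\ll a$. Axiom S2: for all $a,b_1,b_2$ with $b_1\vee b_2\ll a\ne\mathbf 0$ and $b_1\wedge b_2\wedge(\mathbf 1-(\mathbf 1-a))=\mathbf 0$ there are non-zero $a_1,a_2$ with $a-a_2=a_1\ge b_1$, $a-a_1=a_2\ge b_2$, and $a_1\wedge a_2=b_1\wedge b_2$. -}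

module Defs where

open import Level using (Level; _⊔_) renaming (suc to lsuc)
open import Data.Nat using (ℕ)
open import Data.Fin using (Fin)
open import Data.Product using (Σ; _×_; _,_; ∃)
open import Data.Sum using (_⊎_)
open import Relation.Nullary using (¬_)
open import Relation.Binary.PropositionalEquality using (_≡_; _≢_)

-- Co-Heyting algebras: bounded distributive lattices with a binary
-- operation  a - b  = least c with a ≤ b ∨ c.
-- The order is a ≤ b  iff  a ∨ b ≡ b.

record CoHeyting (ℓ : Level) : Set (lsuc ℓ) where
  infixr 6 _∨_
  infixr 7 _∧_
  infixl 8 _-_
  field
    Carrier : Set ℓ
    𝟎 𝟏     : Carrier
    _∨_ _∧_ _-_ : Carrier → Carrier → Carrier
    ∨-comm   : ∀ a b → a ∨ b ≡ b ∨ a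
    ∧-comm   : ∀ a b → a ∧ b ≡ b ∧ a
    ∨-assoc  : ∀ a b c → (a ∨ b) ∨ c ≡ a ∨ (b ∨ c)
    ∧-assoc  : ∀ a b c → (a ∧ b) ∧ c ≡ a ∧ (b ∧ c)
    ∨-absorbs-∧ : ∀ a b → a ∨ (a ∧ b) ≡ a
    ∧-absorbs-∨ : ∀ a b → a ∧ (a ∨ b) ≡ a
    ∧-distrib-∨ : ∀ a b c → a ∧ (b ∨ c) ≡ (a ∧ b) ∨ (a ∧ c)
    𝟎-least    : ∀ a → 𝟎 ∨ a ≡ a
    𝟏-greatest : ∀ a → a ∨ 𝟏 ≡ 𝟏
    -diff-covers : ∀ a b → a ∨ (b ∨ (a - b)) ≡ b ∨ (a - b)
    -diff-least  : ∀ a b c → a ∨ (b ∨ c) ≡ b ∨ c → (a - b) ∨ c ≡ c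

module _ {ℓ : Level} (L : CoHeyting ℓ) where
  open CoHeyting L

  _≤_ : Carrier → Carrier → Set ℓ
  a ≤ b = a ∨ b ≡ b

  _≪_ : Carrier → Carrier → Set ℓ
  b ≪ a = (a - b ≡ a) × (b ≤ a)

  InV2 : Set ℓ
  InV2 = ∀ x → (𝟏 - x) ∧ (𝟏 - (𝟏 - x)) ≡ 𝟎

  D2 : Set ℓ
  D2 = ∀ a c → c ≪ a → a ≢ 𝟎 →
       Σ Carrier λ b → (b ≢ 𝟎) × (c ≪ b) × (b ≪ a)

  S2 : Set ℓ
  S2 = ∀ a b₁ b₂ → (b₁ ∨ b₂) ≪ a → a ≢ 𝟎 →
       (b₁ ∧ b₂) ∧ (𝟏 - (𝟏 - a)) ≡ 𝟎 →
       Σ Carrier λ a₁ → Σ Carrier λ a₂ →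
         (a₁ ≢ 𝟎) × (a₂ ≢ 𝟎) ×
         (a - a₂ ≡ a₁) × (b₁ ≤ a₁) ×
         (a - a₁ ≡ a₂) × (b₂ ≤ a₂) ×
         (a₁ ∧ a₂ ≡ b₁ ∧ b₂)

record Embedding {ℓ ℓ' : Level} (L : CoHeyting ℓ) (M : CoHeyting ℓ')
       : Set (ℓ ⊔ ℓ') where
  private
    module L = CoHeyting L
    module M = CoHeyting M
  field
    f       : L.Carrier → M.Carrier
    f-inj   : ∀ x y → f x ≡ f y → x ≡ y
    f-𝟎     : f L.𝟎 ≡ M.𝟎
    f-𝟏     : f L.𝟏 ≡ M.𝟏
    f-∨     : ∀ x y → f (x L.∨ y) ≡ f x M.∨ f y
    f-∧     : ∀ x y → f (x L.∧ y) ≡ f x M.∧ f y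
    f--     : ∀ x y → f (x L.- y) ≡ f x M.- f y

data Term {ℓ : Level} (P : Set ℓ) (n : ℕ) : Set ℓ where
  var  : Fin n → Term P n
  par  : P → Term P n
  `𝟎 `𝟏 : Term P n
  _`∨_ _`∧_ _`-_ : Term P n → Term P n → Term P n

data QF {ℓ : Level} (P : Set ℓ) (n : ℕ) : Set ℓ where
  _`≈_ : Term P n → Term P n → QF P n
  `¬_  : QF P n → QF P n
  _`&_ _`∣_ : QF P n → QF P n → QF P n

record ExFormula {ℓ : Level} (P : Set ℓ) : Set ℓ where
  constructor ∃[_]_
  field
    nvars  : ℕ
    matrix : QF P nvars

module _ {ℓ ℓ' : Level} {P : Set ℓ} (M : CoHeyting ℓ') (π : P → CoHeyting.Carrier M) where
  open CoHeyting M

  evalT : ∀ {n} → (Fin n → Carrier) → Term P n → Carrier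
  evalT ρ (var i)   = ρ i
  evalT ρ (par p)   = π p
  evalT ρ `𝟎        = 𝟎
  evalT ρ `𝟏        = 𝟏
  evalT ρ (s `∨ t)  = evalT ρ s ∨ evalT ρ t
  evalT ρ (s `∧ t)  = evalT ρ s ∧ evalT ρ t
  evalT ρ (s `- t)  = evalT ρ s - evalT ρ t

  SatQF : ∀ {n} → (Fin n → Carrier) → QF P n → Set ℓ'
  SatQF ρ (s `≈ t) = evalT ρ s ≡ evalT ρ t
  SatQF ρ (`¬ φ)   = ¬ SatQF ρ φ
  SatQF ρ (φ `& ψ) = SatQF ρ φ × SatQF ρ ψ
  SatQF ρ (φ `∣ ψ) = SatQF ρ φ ⊎ SatQF ρ ψ

  SatEx : ExFormula P → Set ℓ'
  SatEx (∃[ n ] φ) = Σ (Fin n → Carrier) λ ρ → SatQF ρ φ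

-- L is existentially closed in 𝒱₂: every existential formula with
-- parameters in L that holds in some extension M ∈ 𝒱₂ of L holds in L.
-- (Extensions range over algebras whose carrier lives in the same
-- universe as L.)

ExistentiallyClosedV2 : ∀ {ℓ} → CoHeyting ℓ → Set (lsuc ℓ)
ExistentiallyClosedV2 {ℓ} L =
  (M : CoHeyting ℓ) → InV2 M → (e : Embedding L M) →
  (φ : ExFormula (CoHeyting.Carrier L)) →
  SatEx M (Embedding.f e) φ → SatEx L (λ x → x) φ

-- An existentially closed L satisfies every existential formula over L that holds in some
-- extension in 𝒱₂, so each axiom follows once one extension containing its witnesses is found.
--
-- D2, for c ≪ a ≠ 𝟎: the pairs u ≤ v of L with u ∧ c = v ∧ c form a co-Heyting algebra
-- containing L as the diagonal, and c ≪ (c , a) ≪ a there.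
--
-- S2, for d = b₁ ∨ b₂ ≪ a: the triples (A₁ , A₂ , B) with A₁ - d = A₁, A₂ - d = A₂,
-- A₁ - a = A₂ - a, B ≤ d and bᵢ ∧ Aᵢ ≤ B form a co-Heyting algebra into which L embeds by
-- x ↦ (x - d , x - d , x ∧ d); it doubles the part of a away from d, and a₁ = (a , 𝟎 , b₁),
-- a₂ = (𝟎 , a , b₂) split a as required.
--
-- Both algebras lie in 𝒱₂ because every 𝟏 - x has a complement there, built from the
-- complement 𝟏 - (𝟏 - y) of 𝟏 - y in L. For the triples this needs b₁ ∧ b₂ ≤ 𝟏 - a, which
-- is what the hypothesis b₁ ∧ b₂ ∧ (𝟏 - (𝟏 - a)) = 𝟎 of S2 says in 𝒱₂.

module Submission where

open import Level using (Level)
open import Data.Nat using (ℕ)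
open import Data.Fin using (Fin; zero; suc)
open import Data.Product using (Σ; _×_; _,_; proj₁; proj₂)
open import Relation.Binary.PropositionalEquality
open import Relation.Binary.Bundles using (Poset)
import Relation.Binary.Reasoning.PartialOrder as PosetReasoning
open import Axiom.UniquenessOfIdentityProofs.WithK using (uip)
open import Defs hiding (_≤_; _≪_)

module CoHeytingProperties {ℓ : Level} (L : CoHeyting ℓ) where
  open CoHeyting L public

  infix 4 _≤_
  _≤_ : Carrier → Carrier → Set ℓ
  _≤_ = Defs._≤_ L

  infix 4 _≪_
  _≪_ : Carrier → Carrier → Set ℓ
  _≪_ = Defs._≪_ L

  ∨-idem : ∀ x → x ∨ x ≡ x
  ∨-idem x = trans (cong (x ∨_) (sym (∧-absorbs-∨ x x))) (∨-absorbs-∧ x (x ∨ x))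

  ≤-refl : ∀ {x} → x ≤ x
  ≤-refl {x} = ∨-idem x

  ≤-reflexive : ∀ {x y} → x ≡ y → x ≤ y
  ≤-reflexive refl = ≤-refl

  ≤-trans : ∀ {x y z} → x ≤ y → y ≤ z → x ≤ z
  ≤-trans {x} {y} {z} x≤y y≤z = begin
    x ∨ z        ≡⟨ cong (x ∨_) (sym y≤z) ⟩
    x ∨ (y ∨ z)  ≡⟨ sym (∨-assoc x y z) ⟩
    (x ∨ y) ∨ z  ≡⟨ cong (_∨ z) x≤y ⟩
    y ∨ z        ≡⟨ y≤z ⟩
    z            ∎
    where open ≡-Reasoning

  ≤-antisym : ∀ {x y} → x ≤ y → y ≤ x → x ≡ y
  ≤-antisym {x} {y} x≤y y≤x = trans (sym y≤x) (trans (∨-comm y x) x≤y)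

  ≤-poset : Poset ℓ ℓ ℓ
  ≤-poset = record
    { isPartialOrder = record
      { isPreorder = record
        { isEquivalence = isEquivalence ; reflexive = ≤-reflexive ; trans = ≤-trans }
      ; antisym = ≤-antisym } }

  module ≤-Reasoning = PosetReasoning ≤-poset

  x≤y⇒x∧y≡x : ∀ {x y} → x ≤ y → x ∧ y ≡ x
  x≤y⇒x∧y≡x {x} {y} x≤y = trans (cong (x ∧_) (sym x≤y)) (∧-absorbs-∨ x y)

  x∧y≡x⇒x≤y : ∀ {x y} → x ∧ y ≡ x → x ≤ y
  x∧y≡x⇒x≤y {x} {y} x∧y≡x = begin
    x ∨ y        ≡⟨ cong (_∨ y) (sym x∧y≡x) ⟩
    (x ∧ y) ∨ y  ≡⟨ ∨-comm (x ∧ y) y ⟩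
    y ∨ (x ∧ y)  ≡⟨ cong (y ∨_) (∧-comm x y) ⟩
    y ∨ (y ∧ x)  ≡⟨ ∨-absorbs-∧ y x ⟩
    y            ∎
    where open ≡-Reasoning

  x≤x∨y : ∀ x y → x ≤ x ∨ y
  x≤x∨y x y = trans (sym (∨-assoc x x y)) (cong (_∨ y) (∨-idem x))

  y≤x∨y : ∀ x y → y ≤ x ∨ y
  y≤x∨y x y = subst (y ≤_) (∨-comm y x) (x≤x∨y y x)

  ∨-least : ∀ {x y z} → x ≤ z → y ≤ z → x ∨ y ≤ z
  ∨-least {x} {y} {z} x≤z y≤z = trans (∨-assoc x y z) (trans (cong (x ∨_) y≤z) x≤z)

  x∧y≤x : ∀ x y → x ∧ y ≤ x
  x∧y≤x x y = trans (∨-comm (x ∧ y) x) (∨-absorbs-∧ x y)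

  x∧y≤y : ∀ x y → x ∧ y ≤ y
  x∧y≤y x y = subst (_≤ y) (∧-comm y x) (x∧y≤x y x)

  ∧-greatest : ∀ {x y z} → z ≤ x → z ≤ y → z ≤ x ∧ y
  ∧-greatest {x} {y} {z} z≤x z≤y = x∧y≡x⇒x≤y (begin
    z ∧ (x ∧ y)  ≡⟨ sym (∧-assoc z x y) ⟩
    (z ∧ x) ∧ y  ≡⟨ cong (_∧ y) (x≤y⇒x∧y≡x z≤x) ⟩
    z ∧ y        ≡⟨ x≤y⇒x∧y≡x z≤y ⟩
    z            ∎)
    where open ≡-Reasoning

  ∨-monotonic : ∀ {x x′ y y′} → x ≤ x′ → y ≤ y′ → x ∨ y ≤ x′ ∨ y′
  ∨-monotonic x≤x′ y≤y′ = ∨-least (≤-trans x≤x′ (x≤x∨y _ _)) (≤-trans y≤y′ (y≤x∨y _ _))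

  ∧-monotonic : ∀ {x x′ y y′} → x ≤ x′ → y ≤ y′ → x ∧ y ≤ x′ ∧ y′
  ∧-monotonic x≤x′ y≤y′ = ∧-greatest (≤-trans (x∧y≤x _ _) x≤x′) (≤-trans (x∧y≤y _ _) y≤y′)

  ≤𝟎⇒≡𝟎 : ∀ {x} → x ≤ 𝟎 → x ≡ 𝟎
  ≤𝟎⇒≡𝟎 x≤𝟎 = ≤-antisym x≤𝟎 (𝟎-least _)

  ∨-identityʳ : ∀ x → x ∨ 𝟎 ≡ x
  ∨-identityʳ x = trans (∨-comm x 𝟎) (𝟎-least x)

  ∧-zeroʳ : ∀ x → x ∧ 𝟎 ≡ 𝟎
  ∧-zeroʳ x = trans (∧-comm x 𝟎) (x≤y⇒x∧y≡x (𝟎-least x))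

  ∧-identityʳ : ∀ x → x ∧ 𝟏 ≡ x
  ∧-identityʳ x = x≤y⇒x∧y≡x (𝟏-greatest x)

  ∧-identityˡ : ∀ x → 𝟏 ∧ x ≡ x
  ∧-identityˡ x = trans (∧-comm 𝟏 x) (∧-identityʳ x)

  ∧-distribʳ-∨ : ∀ x y z → (x ∨ y) ∧ z ≡ (x ∧ z) ∨ (y ∧ z)
  ∧-distribʳ-∨ x y z = trans (∧-comm _ z) (trans (∧-distrib-∨ z x y)
                         (cong₂ _∨_ (∧-comm z x) (∧-comm z y)))

  ∧-distribʳ-∧ : ∀ x y z → (x ∧ y) ∧ z ≡ (x ∧ z) ∧ (y ∧ z)
  ∧-distribʳ-∧ x y z = ≤-antisym
    (∧-greatest (∧-monotonic (x∧y≤x x y) ≤-refl) (∧-monotonic (x∧y≤y x y) ≤-refl))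
    (∧-greatest (∧-monotonic (x∧y≤x x z) (x∧y≤x y z)) (≤-trans (x∧y≤y _ _) (x∧y≤y y z)))

  ∨-distribˡ-∧-≤ : ∀ x y z → (x ∨ y) ∧ (x ∨ z) ≤ x ∨ (y ∧ z)
  ∨-distribˡ-∧-≤ x y z = begin
    (x ∨ y) ∧ (x ∨ z)              ≡⟨ ∧-distrib-∨ (x ∨ y) x z ⟩
    ((x ∨ y) ∧ x) ∨ ((x ∨ y) ∧ z)  ≤⟨ ∨-monotonic (x∧y≤y _ _) (≤-reflexive (∧-distribʳ-∨ x y z)) ⟩
    x ∨ ((x ∧ z) ∨ (y ∧ z))        ≤⟨ ∨-least (x≤x∨y x _) (∨-least (≤-trans (x∧y≤x x z) (x≤x∨y x _)) (y≤x∨y x _)) ⟩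
    x ∨ (y ∧ z)                    ∎
    where open ≤-Reasoning

  x≤y∨[x-y] : ∀ x y → x ≤ y ∨ (x - y)
  x≤y∨[x-y] = -diff-covers

  -least : ∀ {x y z} → x ≤ y ∨ z → x - y ≤ z
  -least {x} {y} {z} = -diff-least x y z

  x-y≤x : ∀ x y → x - y ≤ x
  x-y≤x x y = -least (y≤x∨y y x)

  -monoˡ-≤ : ∀ {x x′} y → x ≤ x′ → x - y ≤ x′ - y
  -monoˡ-≤ y x≤x′ = -least (≤-trans x≤x′ (x≤y∨[x-y] _ y))

  -antitoneʳ-≤ : ∀ x {y y′} → y ≤ y′ → x - y′ ≤ x - y
  -antitoneʳ-≤ x y≤y′ = -least (≤-trans (x≤y∨[x-y] x _) (∨-monotonic y≤y′ ≤-refl))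

  x≤y⇒x-y≡𝟎 : ∀ {x y} → x ≤ y → x - y ≡ 𝟎
  x≤y⇒x-y≡𝟎 {x} {y} x≤y = ≤𝟎⇒≡𝟎 (-least (subst (x ≤_) (sym (∨-identityʳ y)) x≤y))

  x-x≡𝟎 : ∀ x → x - x ≡ 𝟎
  x-x≡𝟎 x = x≤y⇒x-y≡𝟎 ≤-refl

  𝟎-x≡𝟎 : ∀ x → 𝟎 - x ≡ 𝟎
  𝟎-x≡𝟎 x = x≤y⇒x-y≡𝟎 (𝟎-least x)

  -distribʳ-∨ : ∀ x y z → (x ∨ y) - z ≡ (x - z) ∨ (y - z)
  -distribʳ-∨ x y z = ≤-antisym
    (-least (≤-trans (∨-monotonic (x≤y∨[x-y] x z) (x≤y∨[x-y] y z))
       (∨-least (∨-least (x≤x∨y _ _) (≤-trans (x≤x∨y _ _) (y≤x∨y _ _)))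
                (∨-least (x≤x∨y _ _) (≤-trans (y≤x∨y _ _) (y≤x∨y _ _))))))
    (∨-least (-monoˡ-≤ z (x≤x∨y x y)) (-monoˡ-≤ z (y≤x∨y x y)))

  x-[y∨z]≡[x-y]-z : ∀ x y z → x - (y ∨ z) ≡ (x - y) - z
  x-[y∨z]≡[x-y]-z x y z = ≤-antisym
    (-least (begin
      x                      ≤⟨ x≤y∨[x-y] x y ⟩
      y ∨ (x - y)            ≤⟨ ∨-monotonic ≤-refl (x≤y∨[x-y] (x - y) z) ⟩
      y ∨ (z ∨ (x - y) - z)  ≡⟨ sym (∨-assoc y z _) ⟩
      (y ∨ z) ∨ (x - y) - z  ∎))
    (-least (-least (≤-trans (x≤y∨[x-y] x (y ∨ z)) (≤-reflexive (∨-assoc y z _)))))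
    where open ≤-Reasoning

  𝟏-[𝟏-x]≤x : ∀ x → 𝟏 - (𝟏 - x) ≤ x
  𝟏-[𝟏-x]≤x x = -least (≤-trans (x≤y∨[x-y] 𝟏 x) (≤-reflexive (∨-comm x _)))

  -idem : ∀ x y → (x - y) - y ≡ x - y
  -idem x y = trans (sym (x-[y∨z]≡[x-y]-z x y y)) (cong (x -_) (∨-idem y))

  x∨[y-x]≡x∨y : ∀ x y → x ∨ (y - x) ≡ x ∨ y
  x∨[y-x]≡x∨y x y = ≤-antisym (∨-monotonic ≤-refl (x-y≤x y x)) (∨-least (x≤x∨y _ _) (x≤y∨[x-y] y x))

  x≡[x∧y]∨[x-y] : ∀ x y → x ≡ (x ∧ y) ∨ (x - y)
  x≡[x∧y]∨[x-y] x y = ≤-antisym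
    (begin
      x                          ≤⟨ ∧-greatest ≤-refl (x≤y∨[x-y] x y) ⟩
      x ∧ (y ∨ (x - y))          ≡⟨ ∧-distrib-∨ x y (x - y) ⟩
      (x ∧ y) ∨ (x ∧ (x - y))    ≤⟨ ∨-monotonic ≤-refl (x∧y≤y _ _) ⟩
      (x ∧ y) ∨ (x - y)          ∎)
    (∨-least (x∧y≤x _ _) (x-y≤x x y))
    where open ≤-Reasoning

  [x∧y]-k≡[[x-k]∧[y-k]]-k : ∀ x y k → (x ∧ y) - k ≡ ((x - k) ∧ (y - k)) - k
  [x∧y]-k≡[[x-k]∧[y-k]]-k x y k = ≤-antisym
    (-least (begin
      x ∧ y                              ≤⟨ ∧-monotonic (x≤y∨[x-y] x k) (x≤y∨[x-y] y k) ⟩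
      (k ∨ (x - k)) ∧ (k ∨ (y - k))      ≤⟨ ∨-distribˡ-∧-≤ k _ _ ⟩
      k ∨ ((x - k) ∧ (y - k))            ≤⟨ ∨-monotonic ≤-refl (x≤y∨[x-y] _ k) ⟩
      k ∨ (k ∨ ((x - k) ∧ (y - k)) - k)  ≡⟨ sym (∨-assoc k k _) ⟩
      (k ∨ k) ∨ ((x - k) ∧ (y - k)) - k  ≡⟨ cong (_∨ _) (∨-idem k) ⟩
      k ∨ ((x - k) ∧ (y - k)) - k        ∎))
    (-monoˡ-≤ k (∧-monotonic (x-y≤x x k) (x-y≤x y k)))
    where open ≤-Reasoning

  ≪⇒𝟏-x≡𝟏 : ∀ {x a} → x ≪ a → 𝟏 - x ≡ 𝟏
  ≪⇒𝟏-x≡𝟏 {x} {a} (a-x≡a , x≤a) = ≤-antisym (𝟏-greatest _) (begin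
    𝟏            ≤⟨ x≤y∨[x-y] 𝟏 x ⟩
    x ∨ (𝟏 - x)  ≤⟨ ∨-least (begin
                       x          ≤⟨ x≤a ⟩
                       a          ≡⟨ sym a-x≡a ⟩
                       a - x      ≤⟨ -monoˡ-≤ x (𝟏-greatest a) ⟩
                       𝟏 - x      ∎) ≤-refl ⟩
    𝟏 - x        ∎)
    where open ≤-Reasoning

  disjoint-≤ : ∀ {x y z} → x ∧ y ≤ 𝟎 → x ≤ y ∨ z → x ≤ z
  disjoint-≤ {x} {y} {z} x∧y≤𝟎 x≤y∨z = begin
    x                  ≤⟨ ∧-greatest ≤-refl x≤y∨z ⟩
    x ∧ (y ∨ z)        ≡⟨ ∧-distrib-∨ x y z ⟩
    (x ∧ y) ∨ (x ∧ z)  ≤⟨ ∨-least (≤-trans x∧y≤𝟎 (𝟎-least z)) (x∧y≤y x z) ⟩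
    z                  ∎
    where open ≤-Reasoning

  Complements : Carrier → Carrier → Set ℓ
  Complements k k′ = (k ∧ k′ ≡ 𝟎) × (k ∨ k′ ≡ 𝟏)

  Complements-sym : ∀ {k k′} → Complements k k′ → Complements k′ k
  Complements-sym {k} {k′} (meet , join) = trans (∧-comm k′ k) meet , trans (∨-comm k′ k) join

  complement-≤ : ∀ {k k′ x} → Complements k k′ → x ∧ k′ ≤ 𝟎 → x ≤ k
  complement-≤ {k} {k′} {x} (_ , join) x∧k′≤𝟎 =
    disjoint-≤ x∧k′≤𝟎 (≤-trans (𝟏-greatest x) (≤-reflexive (sym (trans (∨-comm k′ k) join))))

  𝟏-k≡k′ : ∀ {k k′} → Complements k k′ → 𝟏 - k ≡ k′
  𝟏-k≡k′ {k} {k′} (meet , join) = ≤-antisym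
    (-least (≤-reflexive (sym join)))
    (disjoint-≤ (≤-reflexive (trans (∧-comm k′ k) meet)) (≤-trans (𝟏-greatest k′) (x≤y∨[x-y] 𝟏 k)))

  [x-y]∧k≤[x∧k]-y : ∀ {k k′} → Complements k k′ → ∀ x y → (x - y) ∧ k ≤ (x ∧ k) - y
  [x-y]∧k≤[x∧k]-y {k} {k′} (meet , join) x y = disjoint-≤
    (≤-trans (≤-reflexive (∧-assoc (x - y) k k′)) (≤-trans (∧-monotonic ≤-refl (≤-reflexive meet)) (x∧y≤y _ _)))
    (≤-trans (x∧y≤x _ _) (-least (begin
      x                          ≤⟨ ∧-greatest ≤-refl (≤-trans (𝟏-greatest x) (≤-reflexive (sym join))) ⟩
      x ∧ (k ∨ k′)               ≡⟨ ∧-distrib-∨ x k k′ ⟩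
      (x ∧ k) ∨ (x ∧ k′)         ≤⟨ ∨-monotonic (x≤y∨[x-y] (x ∧ k) y) (x∧y≤y x k′) ⟩
      (y ∨ (x ∧ k) - y) ∨ k′     ≤⟨ ∨-least (∨-monotonic ≤-refl (y≤x∨y k′ _)) (≤-trans (x≤x∨y k′ _) (y≤x∨y y _)) ⟩
      y ∨ (k′ ∨ (x ∧ k) - y)     ∎)))
    where open ≤-Reasoning

  x-[y∨z]≡[x-z]-[y-z] : ∀ x y z → x - (y ∨ z) ≡ (x - z) - (y - z)
  x-[y∨z]≡[x-z]-[y-z] x y z = begin
    x - (y ∨ z)        ≡⟨ cong (x -_) (trans (∨-comm y z) (sym (x∨[y-x]≡x∨y z y))) ⟩
    x - (z ∨ (y - z))  ≡⟨ x-[y∨z]≡[x-y]-z x z (y - z) ⟩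
    (x - z) - (y - z)  ∎
    where open ≡-Reasoning

  -absorbˡ : ∀ x {y z} → z ≤ y → (x - z) - y ≡ x - y
  -absorbˡ x {y} {z} z≤y = trans (sym (x-[y∨z]≡[x-y]-z x z y)) (cong (x -_) z≤y)

  -absorbʳ : ∀ x {y z} → z ≤ y → (x - y) - z ≡ x - y
  -absorbʳ x {y} {z} z≤y = trans (sym (x-[y∨z]≡[x-y]-z x y z)) (cong (x -_) (trans (∨-comm y z) z≤y))

  [[x-k]∧y]-k≡[x∧y]-k : ∀ x y k → ((x - k) ∧ y) - k ≡ (x ∧ y) - k
  [[x-k]∧y]-k≡[x∧y]-k x y k = begin
    ((x - k) ∧ y) - k                ≡⟨ [x∧y]-k≡[[x-k]∧[y-k]]-k (x - k) y k ⟩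
    (((x - k) - k) ∧ (y - k)) - k    ≡⟨ cong (λ z → (z ∧ (y - k)) - k) (-idem x k) ⟩
    ((x - k) ∧ (y - k)) - k          ≡⟨ sym ([x∧y]-k≡[[x-k]∧[y-k]]-k x y k) ⟩
    (x ∧ y) - k                      ∎
    where open ≡-Reasoning

  [x∧[y-k]]-k≡[x∧y]-k : ∀ x y k → (x ∧ (y - k)) - k ≡ (x ∧ y) - k
  [x∧[y-k]]-k≡[x∧y]-k x y k = trans (cong (_- k) (∧-comm x _))
    (trans ([[x-k]∧y]-k≡[x∧y]-k y x k) (cong (_- k) (∧-comm y x)))

  [x∧z]-[y∧z]≡[x∧z]-y : ∀ x y z → (x ∧ z) - (y ∧ z) ≡ (x ∧ z) - y
  [x∧z]-[y∧z]≡[x∧z]-y x y z = ≤-antisym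
    (-least (begin
      x ∧ z                              ≤⟨ ∧-greatest (x≤y∨[x-y] (x ∧ z) y) (x∧y≤y x z) ⟩
      (y ∨ (x ∧ z) - y) ∧ z              ≡⟨ ∧-distribʳ-∨ y _ z ⟩
      (y ∧ z) ∨ (((x ∧ z) - y) ∧ z)      ≤⟨ ∨-monotonic ≤-refl (x∧y≤x _ _) ⟩
      (y ∧ z) ∨ (x ∧ z) - y              ∎))
    (-antitoneʳ-≤ (x ∧ z) (x∧y≤x y z))
    where open ≤-Reasoning

  x-y≡[[x∧z]-y]∨[x-[y∨z]] : ∀ x y z → x - y ≡ ((x ∧ z) - y) ∨ (x - (y ∨ z))
  x-y≡[[x∧z]-y]∨[x-[y∨z]] x y z = begin
    x - y                                ≡⟨ cong (_- y) (x≡[x∧y]∨[x-y] x z) ⟩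
    ((x ∧ z) ∨ (x - z)) - y              ≡⟨ -distribʳ-∨ (x ∧ z) (x - z) y ⟩
    ((x ∧ z) - y) ∨ ((x - z) - y)        ≡⟨ cong (((x ∧ z) - y) ∨_) (sym (x-[y∨z]≡[x-y]-z x z y)) ⟩
    ((x ∧ z) - y) ∨ (x - (z ∨ y))        ≡⟨ cong (λ w → ((x ∧ z) - y) ∨ (x - w)) (∨-comm z y) ⟩
    ((x ∧ z) - y) ∨ (x - (y ∨ z))        ∎
    where open ≡-Reasoning

  x≤[x∧k]∨[x∧k′] : ∀ {k k′} → Complements k k′ → ∀ x → x ≤ (x ∧ k) ∨ (x ∧ k′)
  x≤[x∧k]∨[x∧k′] {k} {k′} (_ , join) x = begin
    x                   ≤⟨ ∧-greatest ≤-refl (≤-trans (𝟏-greatest x) (≤-reflexive (sym join))) ⟩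
    x ∧ (k ∨ k′)        ≡⟨ ∧-distrib-∨ x k k′ ⟩
    (x ∧ k) ∨ (x ∧ k′)  ∎
    where open ≤-Reasoning

  [𝟏-y]∧k≡k-y : ∀ {k k′} → Complements k k′ → ∀ y → (𝟏 - y) ∧ k ≡ k - y
  [𝟏-y]∧k≡k-y {k} compl y = ≤-antisym
    (≤-trans ([x-y]∧k≤[x∧k]-y compl 𝟏 y) (≤-reflexive (cong (_- y) (∧-identityˡ k))))
    (∧-greatest (-monoˡ-≤ y (𝟏-greatest k)) (x-y≤x k y))

  ∧-complement-cong : ∀ {s k₁ k₁′ k₂ k₂′} → Complements k₁ k₁′ → Complements k₂ k₂′ →
                      s ∧ k₁ ≡ s ∧ k₂ → s ∧ k₁′ ≡ s ∧ k₂′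
  ∧-complement-cong c₁ c₂ s∧k₁≡s∧k₂ = ≤-antisym (one-way c₁ c₂ s∧k₁≡s∧k₂) (one-way c₂ c₁ (sym s∧k₁≡s∧k₂))
    where
    one-way : ∀ {s k₁ k₁′ k₂ k₂′} → Complements k₁ k₁′ → Complements k₂ k₂′ →
              s ∧ k₁ ≡ s ∧ k₂ → s ∧ k₁′ ≤ s ∧ k₂′
    one-way {s} {k₁} {k₁′} {k₂} {k₂′} (meet₁ , _) c₂ s∧k₁≡s∧k₂ =
      ∧-greatest (x∧y≤x s k₁′) (complement-≤ (Complements-sym c₂) (begin
        (s ∧ k₁′) ∧ k₂    ≤⟨ ∧-greatest (∧-greatest (≤-trans (x∧y≤x _ _) (x∧y≤x s k₁′)) (x∧y≤y _ _))
                                        (≤-trans (x∧y≤x _ _) (x∧y≤y s k₁′)) ⟩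
        (s ∧ k₂) ∧ k₁′    ≡⟨ cong (_∧ k₁′) (sym s∧k₁≡s∧k₂) ⟩
        (s ∧ k₁) ∧ k₁′    ≤⟨ ∧-monotonic (x∧y≤y s k₁) ≤-refl ⟩
        k₁ ∧ k₁′          ≡⟨ meet₁ ⟩
        𝟎                 ∎))
      where open ≤-Reasoning

  x-y≡z-y⇒y∨x≡y∨z : ∀ {x y z} → x - y ≡ z - y → y ∨ x ≡ y ∨ z
  x-y≡z-y⇒y∨x≡y∨z {x} {y} {z} x-y≡z-y = begin
    y ∨ x        ≡⟨ sym (x∨[y-x]≡x∨y y x) ⟩
    y ∨ (x - y)  ≡⟨ cong (y ∨_) x-y≡z-y ⟩
    y ∨ (z - y)  ≡⟨ x∨[y-x]≡x∨y y z ⟩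
    y ∨ z        ∎
    where open ≡-Reasoning

  InV2-if-𝟏-x-complemented : (∀ x → Σ Carrier (Complements (𝟏 - x))) → InV2 L
  InV2-if-𝟏-x-complemented complemented x with complemented x
  ... | k′ , compl = trans (cong ((𝟏 - x) ∧_) (𝟏-k≡k′ compl)) (proj₁ compl)

  module InV2Properties (v2 : InV2 L) where

    𝟏-x-complements : ∀ x → Complements (𝟏 - x) (𝟏 - (𝟏 - x))
    𝟏-x-complements x = v2 x , ≤-antisym (𝟏-greatest _) (x≤y∨[x-y] 𝟏 (𝟏 - x))

    [𝟏-x]∧[𝟏-y]≡𝟏-[x∨y] : ∀ x y → (𝟏 - x) ∧ (𝟏 - y) ≡ 𝟏 - (x ∨ y)
    [𝟏-x]∧[𝟏-y]≡𝟏-[x∨y] x y = ≤-antisym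
      (begin
        (𝟏 - x) ∧ (𝟏 - y)          ≡⟨ ∧-comm _ _ ⟩
        (𝟏 - y) ∧ (𝟏 - x)          ≡⟨ cong (_∧ (𝟏 - x)) (sym (-idem 𝟏 y)) ⟩
        ((𝟏 - y) - y) ∧ (𝟏 - x)    ≤⟨ [x-y]∧k≤[x∧k]-y (𝟏-x-complements x) (𝟏 - y) y ⟩
        ((𝟏 - y) ∧ (𝟏 - x)) - y    ≤⟨ -monoˡ-≤ y (x∧y≤y _ _) ⟩
        (𝟏 - x) - y                ≡⟨ sym (x-[y∨z]≡[x-y]-z 𝟏 x y) ⟩
        𝟏 - (x ∨ y)                ∎)
      (∧-greatest (-antitoneʳ-≤ 𝟏 (x≤x∨y x y)) (-antitoneʳ-≤ 𝟏 (y≤x∨y x y)))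
      where open ≤-Reasoning

module _ {ℓ ℓ′ : Level} {L : CoHeyting ℓ} {M : CoHeyting ℓ′} (e : Embedding L M) where
  private
    module L = CoHeytingProperties L
    module M = CoHeytingProperties M
  open Embedding e

  Embedding-preserves-Complements : ∀ {k k′} → L.Complements k k′ → M.Complements (f k) (f k′)
  Embedding-preserves-Complements {k} {k′} (meet , join) =
    trans (sym (f-∧ k k′)) (trans (cong f meet) f-𝟎) ,
    trans (sym (f-∨ k k′)) (trans (cong f join) f-𝟏)

module D2Extension {ℓ : Level} (L : CoHeyting ℓ) (c : CoHeyting.Carrier L) where
  open CoHeytingProperties L

  record Pair : Set ℓ where
    constructor pair
    field
      lo hi : Carrier
      lo≤hi : lo ≤ hi
      agree : lo ∧ c ≡ hi ∧ c
  open Pair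

  Pair-≡ : ∀ {x y : Pair} → lo x ≡ lo y → hi x ≡ hi y → x ≡ y
  Pair-≡ {pair _ _ p q} {pair _ _ p′ q′} refl refl = cong₂ (pair _ _) (uip p p′) (uip q q′)

  x∨[c∧y]≡x : ∀ {x y} → y ≤ x → x ∨ (c ∧ y) ≡ x
  x∨[c∧y]≡x y≤x = ≤-antisym (∨-least ≤-refl (≤-trans (x∧y≤y _ _) y≤x)) (x≤x∨y _ _)

  [c∧x]∧c≡x∧c : ∀ x → (c ∧ x) ∧ c ≡ x ∧ c
  [c∧x]∧c≡x∧c x = ≤-antisym (∧-greatest (≤-trans (x∧y≤x _ _) (x∧y≤y _ _)) (x∧y≤y _ _))
                            (∧-greatest (∧-greatest (x∧y≤y _ _) (x∧y≤x _ _)) (x∧y≤y _ _))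

  𝟘 𝟙 : Pair
  𝟘 = pair 𝟎 𝟎 ≤-refl refl
  𝟙 = pair 𝟏 𝟏 ≤-refl refl

  infixr 6 _⊔_
  infixr 7 _⊓_
  infixl 8 _∖_
  _⊔_ _⊓_ _∖_ : Pair → Pair → Pair
  pair u v p q ⊔ pair u′ v′ p′ q′ =
    pair (u ∨ u′) (v ∨ v′) (∨-monotonic p p′)
         (trans (∧-distribʳ-∨ u u′ c) (trans (cong₂ _∨_ q q′) (sym (∧-distribʳ-∨ v v′ c))))
  pair u v p q ⊓ pair u′ v′ p′ q′ =
    pair (u ∧ u′) (v ∧ v′) (∧-monotonic p p′)
         (trans (∧-distribʳ-∧ u u′ c) (trans (cong₂ _∧_ q q′) (sym (∧-distribʳ-∧ v v′ c))))
  -- The c ∧ (v - v′) summand restores agreement below c.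
  pair u v p q ∖ pair u′ v′ p′ q′ =
    pair ((u - u′) ∨ (c ∧ (v - v′))) ((u - u′) ∨ (v - v′))
         (∨-monotonic ≤-refl (x∧y≤y _ _))
         (trans (∧-distribʳ-∨ _ _ c) (trans (cong ((u - u′) ∧ c ∨_) ([c∧x]∧c≡x∧c _)) (sym (∧-distribʳ-∨ _ _ c))))

  ∖-least : ∀ x y z → x ⊔ (y ⊔ z) ≡ y ⊔ z → (x ∖ y) ⊔ z ≡ z
  ∖-least (pair u v _ _) (pair u′ v′ _ _) (pair u″ v″ p″ q″) x≤y⊔z =
    Pair-≡ (∨-least lo≤ (begin
             c ∧ (v - v′)  ≤⟨ ∧-monotonic ≤-refl hi≤ ⟩
             c ∧ v″        ≡⟨ trans (∧-comm c v″) (sym q″) ⟩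
             u″ ∧ c        ≤⟨ x∧y≤x _ _ ⟩
             u″            ∎))
           (∨-least (≤-trans lo≤ p″) hi≤)
    where
    open ≤-Reasoning
    lo≤ : u - u′ ≤ u″
    lo≤ = -least (cong lo x≤y⊔z)
    hi≤ : v - v′ ≤ v″
    hi≤ = -least (cong hi x≤y⊔z)

  extension : CoHeyting ℓ
  extension = record
    { Carrier = Pair ; 𝟎 = 𝟘 ; 𝟏 = 𝟙 ; _∨_ = _⊔_ ; _∧_ = _⊓_ ; _-_ = _∖_
    ; ∨-comm = λ x y → Pair-≡ (∨-comm (lo x) (lo y)) (∨-comm (hi x) (hi y))
    ; ∧-comm = λ x y → Pair-≡ (∧-comm (lo x) (lo y)) (∧-comm (hi x) (hi y))
    ; ∨-assoc = λ x y z → Pair-≡ (∨-assoc (lo x) (lo y) (lo z)) (∨-assoc (hi x) (hi y) (hi z))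
    ; ∧-assoc = λ x y z → Pair-≡ (∧-assoc (lo x) (lo y) (lo z)) (∧-assoc (hi x) (hi y) (hi z))
    ; ∨-absorbs-∧ = λ x y → Pair-≡ (∨-absorbs-∧ (lo x) (lo y)) (∨-absorbs-∧ (hi x) (hi y))
    ; ∧-absorbs-∨ = λ x y → Pair-≡ (∧-absorbs-∨ (lo x) (lo y)) (∧-absorbs-∨ (hi x) (hi y))
    ; ∧-distrib-∨ = λ x y z → Pair-≡ (∧-distrib-∨ (lo x) (lo y) (lo z)) (∧-distrib-∨ (hi x) (hi y) (hi z))
    ; 𝟎-least = λ x → Pair-≡ (𝟎-least (lo x)) (𝟎-least (hi x))
    ; 𝟏-greatest = λ x → Pair-≡ (𝟏-greatest (lo x)) (𝟏-greatest (hi x))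
    ; -diff-covers = λ x y → Pair-≡
        (≤-trans (x≤y∨[x-y] (lo x) (lo y)) (∨-monotonic ≤-refl (x≤x∨y _ _)))
        (≤-trans (x≤y∨[x-y] (hi x) (hi y)) (∨-monotonic ≤-refl (y≤x∨y _ _)))
    ; -diff-least = ∖-least
    }

  diagonal : Carrier → Pair
  diagonal x = pair x x ≤-refl refl

  diagonal-embedding : Embedding L extension
  diagonal-embedding = record
    { f = diagonal ; f-inj = λ _ _ → cong lo ; f-𝟎 = refl ; f-𝟏 = refl
    ; f-∨ = λ _ _ → Pair-≡ refl refl ; f-∧ = λ _ _ → Pair-≡ refl refl
    ; f-- = λ x y → Pair-≡ (sym (x∨[c∧y]≡x ≤-refl)) (sym (∨-idem _)) }

  𝟙∖x≡diagonal[𝟏-lo] : ∀ x → 𝟙 ∖ x ≡ diagonal (𝟏 - lo x)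
  𝟙∖x≡diagonal[𝟏-lo] (pair u v u≤v _) = Pair-≡ (x∨[c∧y]≡x 𝟏-v≤𝟏-u) (trans (∨-comm _ _) 𝟏-v≤𝟏-u)
    where
    𝟏-v≤𝟏-u : 𝟏 - v ≤ 𝟏 - u
    𝟏-v≤𝟏-u = -antitoneʳ-≤ 𝟏 u≤v

  extension-InV2 : InV2 L → InV2 extension
  extension-InV2 v2 = M.InV2-if-𝟏-x-complemented λ x →
    diagonal (𝟏 - (𝟏 - lo x)) ,
    subst (λ t → M.Complements t (diagonal (𝟏 - (𝟏 - lo x))))
          (sym (𝟙∖x≡diagonal[𝟏-lo] x))
          (Embedding-preserves-Complements diagonal-embedding (𝟏-x-complements (lo x)))
    where
    module M = CoHeytingProperties extension
    open InV2Properties v2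

  module _ {a : Carrier} (c≪a : c ≪ a) where
    private module M = CoHeytingProperties extension

    c≤a : c ≤ a
    c≤a = proj₂ c≪a

    gap : Pair
    gap = pair c a c≤a (trans (x≤y⇒x∧y≡x ≤-refl) (sym (trans (∧-comm a c) (x≤y⇒x∧y≡x c≤a))))

    diagonal-c≪gap : diagonal c M.≪ gap
    diagonal-c≪gap =
      Pair-≡ (trans (cong₂ _∨_ (x-x≡𝟎 c) (cong (c ∧_) (proj₁ c≪a))) (trans (𝟎-least _) (x≤y⇒x∧y≡x c≤a)))
             (trans (cong₂ _∨_ (x-x≡𝟎 c) (proj₁ c≪a)) (𝟎-least a)) ,
      Pair-≡ (∨-idem c) c≤a

    gap≪diagonal-a : gap M.≪ diagonal a
    gap≪diagonal-a =
      Pair-≡ (trans (cong₂ _∨_ (proj₁ c≪a) (trans (cong (c ∧_) (x-x≡𝟎 a)) (∧-zeroʳ c))) (∨-identityʳ a))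
             (trans (cong₂ _∨_ (proj₁ c≪a) (x-x≡𝟎 a)) (∨-identityʳ a)) ,
      Pair-≡ c≤a (∨-idem a)

module S2Extension {ℓ : Level} (L : CoHeyting ℓ) (a b₁ b₂ : CoHeyting.Carrier L)
                   (d≪a : Defs._≪_ L (CoHeyting._∨_ L b₁ b₂) a) where
  open CoHeytingProperties L

  d : Carrier
  d = b₁ ∨ b₂

  d≤a : d ≤ a
  d≤a = proj₂ d≪a

  b₁≤d : b₁ ≤ d
  b₁≤d = x≤x∨y b₁ b₂

  b₂≤d : b₂ ≤ d
  b₂≤d = y≤x∨y b₁ b₂

  record Triple : Set ℓ where
    constructor triple
    field
      A₁ A₂ B : Carrier
      A₁-d≡A₁ : A₁ - d ≡ A₁
      A₂-d≡A₂ : A₂ - d ≡ A₂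
      agree : A₁ - a ≡ A₂ - a
      B≤d : B ≤ d
      b₁∧A₁≤B : b₁ ∧ A₁ ≤ B
      b₂∧A₂≤B : b₂ ∧ A₂ ≤ B
  open Triple

  Triple-≡ : ∀ {x y : Triple} → A₁ x ≡ A₁ y → A₂ x ≡ A₂ y → B x ≡ B y → x ≡ y
  Triple-≡ {triple _ _ _ p₁ p₂ p₃ p₄ p₅ p₆} {triple _ _ _ q₁ q₂ q₃ q₄ q₅ q₆} refl refl refl
    rewrite uip p₁ q₁ | uip p₂ q₂ | uip p₃ q₃ | uip p₄ q₄ | uip p₅ q₅ | uip p₆ q₆ = refl

  [x-[y∨d]]-a≡[x-a]-[y-a] : ∀ x y → (x - (y ∨ d)) - a ≡ (x - a) - (y - a)
  [x-[y∨d]]-a≡[x-a]-[y-a] x y = begin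
    (x - (y ∨ d)) - a    ≡⟨ sym (x-[y∨z]≡[x-y]-z x (y ∨ d) a) ⟩
    x - ((y ∨ d) ∨ a)    ≡⟨ cong (x -_) (trans (∨-assoc y d a) (cong (y ∨_) d≤a)) ⟩
    x - (y ∨ a)          ≡⟨ x-[y∨z]≡[x-z]-[y-z] x y a ⟩
    (x - a) - (y - a)    ∎
    where open ≡-Reasoning

  𝟘 𝟙 : Triple
  𝟘 = triple 𝟎 𝟎 𝟎 (𝟎-x≡𝟎 d) (𝟎-x≡𝟎 d) refl (𝟎-least d)
             (≤-reflexive (∧-zeroʳ b₁)) (≤-reflexive (∧-zeroʳ b₂))
  𝟙 = triple 𝟏 𝟏 d (≪⇒𝟏-x≡𝟏 d≪a) (≪⇒𝟏-x≡𝟏 d≪a) refl ≤-refl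
             (≤-trans (x∧y≤x _ _) b₁≤d) (≤-trans (x∧y≤x _ _) b₂≤d)

  infixr 6 _⊔_
  infixr 7 _⊓_
  infixl 8 _∖_
  _⊔_ _⊓_ _∖_ : Triple → Triple → Triple
  triple x₁ x₂ x₃ n₁ n₂ g bd c₁ c₂ ⊔ triple y₁ y₂ y₃ m₁ m₂ h be e₁ e₂ =
    triple (x₁ ∨ y₁) (x₂ ∨ y₂) (x₃ ∨ y₃)
      (trans (-distribʳ-∨ x₁ y₁ d) (cong₂ _∨_ n₁ m₁))
      (trans (-distribʳ-∨ x₂ y₂ d) (cong₂ _∨_ n₂ m₂))
      (trans (-distribʳ-∨ x₁ y₁ a) (trans (cong₂ _∨_ g h) (sym (-distribʳ-∨ x₂ y₂ a))))
      (∨-least bd be)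
      (≤-trans (≤-reflexive (∧-distrib-∨ b₁ x₁ y₁)) (∨-monotonic c₁ e₁))
      (≤-trans (≤-reflexive (∧-distrib-∨ b₂ x₂ y₂)) (∨-monotonic c₂ e₂))
  triple x₁ x₂ x₃ n₁ n₂ g bd c₁ c₂ ⊓ triple y₁ y₂ y₃ m₁ m₂ h be e₁ e₂ =
    triple ((x₁ ∧ y₁) - d) ((x₂ ∧ y₂) - d) (x₃ ∧ y₃)
      (-idem _ d) (-idem _ d)
      (begin
        ((x₁ ∧ y₁) - d) - a              ≡⟨ -absorbˡ _ d≤a ⟩
        (x₁ ∧ y₁) - a                    ≡⟨ [x∧y]-k≡[[x-k]∧[y-k]]-k x₁ y₁ a ⟩
        ((x₁ - a) ∧ (y₁ - a)) - a        ≡⟨ cong₂ (λ u v → (u ∧ v) - a) g h ⟩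
        ((x₂ - a) ∧ (y₂ - a)) - a        ≡⟨ sym ([x∧y]-k≡[[x-k]∧[y-k]]-k x₂ y₂ a) ⟩
        (x₂ ∧ y₂) - a                    ≡⟨ sym (-absorbˡ _ d≤a) ⟩
        ((x₂ ∧ y₂) - d) - a              ∎)
      (≤-trans (x∧y≤x _ _) bd)
      (∧-greatest (≤-trans (∧-monotonic ≤-refl (≤-trans (x-y≤x _ d) (x∧y≤x _ _))) c₁)
                  (≤-trans (∧-monotonic ≤-refl (≤-trans (x-y≤x _ d) (x∧y≤y _ _))) e₁))
      (∧-greatest (≤-trans (∧-monotonic ≤-refl (≤-trans (x-y≤x _ d) (x∧y≤x _ _))) c₂)
                  (≤-trans (∧-monotonic ≤-refl (≤-trans (x-y≤x _ d) (x∧y≤y _ _))) e₂))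
    where open ≡-Reasoning
  triple x₁ x₂ x₃ n₁ n₂ g bd c₁ c₂ ∖ triple y₁ y₂ y₃ m₁ m₂ h be e₁ e₂ =
    triple (x₁ - (y₁ ∨ d)) (x₂ - (y₂ ∨ d))
      ((x₃ - y₃) ∨ ((b₁ ∧ (x₁ - (y₁ ∨ d))) ∨ (b₂ ∧ (x₂ - (y₂ ∨ d)))))
      (-absorbʳ x₁ (y≤x∨y y₁ d)) (-absorbʳ x₂ (y≤x∨y y₂ d))
      (trans ([x-[y∨d]]-a≡[x-a]-[y-a] x₁ y₁) (trans (cong₂ _-_ g h) (sym ([x-[y∨d]]-a≡[x-a]-[y-a] x₂ y₂))))
      (∨-least (≤-trans (x-y≤x x₃ y₃) bd)
               (∨-least (≤-trans (x∧y≤x _ _) b₁≤d) (≤-trans (x∧y≤x _ _) b₂≤d)))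
      (≤-trans (x≤x∨y _ _) (y≤x∨y _ _))
      (≤-trans (y≤x∨y _ _) (y≤x∨y _ _))

  ∖-covers : ∀ x y → x ⊔ (y ⊔ (x ∖ y)) ≡ y ⊔ (x ∖ y)
  ∖-covers x y = Triple-≡ (covers (A₁ x) (A₁ y) (A₁-d≡A₁ x)) (covers (A₂ x) (A₂ y) (A₂-d≡A₂ x))
                          (≤-trans (x≤y∨[x-y] (B x) (B y)) (∨-monotonic ≤-refl (x≤x∨y _ _)))
    where
    covers : ∀ u v → u - d ≡ u → u ≤ v ∨ (u - (v ∨ d))
    covers u v u-d≡u = subst (_≤ v ∨ (u - (v ∨ d))) u-d≡u (-least (begin
      u                          ≤⟨ x≤y∨[x-y] u (v ∨ d) ⟩
      (v ∨ d) ∨ (u - (v ∨ d))    ≤⟨ ∨-least (∨-least (≤-trans (x≤x∨y v _) (y≤x∨y d _)) (x≤x∨y d _))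
                                            (≤-trans (y≤x∨y v _) (y≤x∨y d _)) ⟩
      d ∨ (v ∨ (u - (v ∨ d)))    ∎))
      where open ≤-Reasoning

  ∖-least : ∀ x y z → x ⊔ (y ⊔ z) ≡ y ⊔ z → (x ∖ y) ⊔ z ≡ z
  ∖-least x y z x≤y⊔z = Triple-≡ A₁≤ A₂≤
    (∨-least (-least (cong B x≤y⊔z))
             (∨-least (≤-trans (∧-monotonic ≤-refl A₁≤) (b₁∧A₁≤B z))
                      (≤-trans (∧-monotonic ≤-refl A₂≤) (b₂∧A₂≤B z))))
    where
    A₁≤ : A₁ x - (A₁ y ∨ d) ≤ A₁ z
    A₁≤ = ≤-trans (-antitoneʳ-≤ (A₁ x) (x≤x∨y _ d)) (-least (cong A₁ x≤y⊔z))
    A₂≤ : A₂ x - (A₂ y ∨ d) ≤ A₂ z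
    A₂≤ = ≤-trans (-antitoneʳ-≤ (A₂ x) (x≤x∨y _ d)) (-least (cong A₂ x≤y⊔z))

  extension : CoHeyting ℓ
  extension = record
    { Carrier = Triple ; 𝟎 = 𝟘 ; 𝟏 = 𝟙 ; _∨_ = _⊔_ ; _∧_ = _⊓_ ; _-_ = _∖_
    ; ∨-comm = λ x y → Triple-≡ (∨-comm (A₁ x) (A₁ y)) (∨-comm (A₂ x) (A₂ y)) (∨-comm (B x) (B y))
    ; ∧-comm = λ x y → Triple-≡ (cong (_- d) (∧-comm (A₁ x) (A₁ y))) (cong (_- d) (∧-comm (A₂ x) (A₂ y)))
                                (∧-comm (B x) (B y))
    ; ∨-assoc = λ x y z → Triple-≡ (∨-assoc (A₁ x) (A₁ y) (A₁ z)) (∨-assoc (A₂ x) (A₂ y) (A₂ z))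
                                   (∨-assoc (B x) (B y) (B z))
    ; ∧-assoc = λ x y z → Triple-≡ (∧-assoc-A (A₁ x) (A₁ y) (A₁ z)) (∧-assoc-A (A₂ x) (A₂ y) (A₂ z))
                                   (∧-assoc (B x) (B y) (B z))
    ; ∨-absorbs-∧ = λ x y → Triple-≡ (∨-absorbs-∧-A (A₁ x) (A₁ y)) (∨-absorbs-∧-A (A₂ x) (A₂ y))
                                     (∨-absorbs-∧ (B x) (B y))
    ; ∧-absorbs-∨ = λ x y → Triple-≡ (trans (cong (_- d) (∧-absorbs-∨ (A₁ x) (A₁ y))) (A₁-d≡A₁ x))
                                     (trans (cong (_- d) (∧-absorbs-∨ (A₂ x) (A₂ y))) (A₂-d≡A₂ x))
                                     (∧-absorbs-∨ (B x) (B y))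
    ; ∧-distrib-∨ = λ x y z → Triple-≡ (∧-distrib-∨-A (A₁ x) (A₁ y) (A₁ z))
                                       (∧-distrib-∨-A (A₂ x) (A₂ y) (A₂ z))
                                       (∧-distrib-∨ (B x) (B y) (B z))
    ; 𝟎-least = λ x → Triple-≡ (𝟎-least (A₁ x)) (𝟎-least (A₂ x)) (𝟎-least (B x))
    ; 𝟏-greatest = λ x → Triple-≡ (𝟏-greatest (A₁ x)) (𝟏-greatest (A₂ x)) (B≤d x)
    ; -diff-covers = ∖-covers
    ; -diff-least = ∖-least
    }
    where
    ∧-assoc-A : ∀ x y z → (((x ∧ y) - d) ∧ z) - d ≡ (x ∧ ((y ∧ z) - d)) - d
    ∧-assoc-A x y z = trans ([[x-k]∧y]-k≡[x∧y]-k (x ∧ y) z d)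
      (trans (cong (_- d) (∧-assoc x y z)) (sym ([x∧[y-k]]-k≡[x∧y]-k x (y ∧ z) d)))
    ∨-absorbs-∧-A : ∀ x y → x ∨ ((x ∧ y) - d) ≡ x
    ∨-absorbs-∧-A x y = ≤-antisym (∨-least ≤-refl (≤-trans (x-y≤x _ d) (x∧y≤x x y))) (x≤x∨y _ _)
    ∧-distrib-∨-A : ∀ x y z → (x ∧ (y ∨ z)) - d ≡ ((x ∧ y) - d) ∨ ((x ∧ z) - d)
    ∧-distrib-∨-A x y z = trans (cong (_- d) (∧-distrib-∨ x y z)) (-distribʳ-∨ _ _ d)

  embed : Carrier → Triple
  embed x = triple (x - d) (x - d) (x ∧ d) (-idem x d) (-idem x d) refl (x∧y≤y x d)
    (∧-greatest (≤-trans (x∧y≤y _ _) (x-y≤x x d)) (≤-trans (x∧y≤x _ _) b₁≤d))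
    (∧-greatest (≤-trans (x∧y≤y _ _) (x-y≤x x d)) (≤-trans (x∧y≤x _ _) b₂≤d))

  [x-d]-[[y-d]∨d]≡x-[y∨d] : ∀ x y → (x - d) - ((y - d) ∨ d) ≡ x - (y ∨ d)
  [x-d]-[[y-d]∨d]≡x-[y∨d] x y = begin
    (x - d) - ((y - d) ∨ d)  ≡⟨ cong ((x - d) -_) (trans (∨-comm _ d) (x∨[y-x]≡x∨y d y)) ⟩
    (x - d) - (d ∨ y)        ≡⟨ cong ((x - d) -_) (∨-comm d y) ⟩
    (x - d) - (y ∨ d)        ≡⟨ -absorbˡ x (y≤x∨y y d) ⟩
    x - (y ∨ d)              ∎
    where open ≡-Reasoning

  [x-y]∧d-split : ∀ x y → (x - y) ∧ d ≡ ((x ∧ d) - (y ∧ d)) ∨ ((b₁ ∧ (x - (y ∨ d))) ∨ (b₂ ∧ (x - (y ∨ d))))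
  [x-y]∧d-split x y = begin
    (x - y) ∧ d                                         ≡⟨ cong (_∧ d) (x-y≡[[x∧z]-y]∨[x-[y∨z]] x y d) ⟩
    (((x ∧ d) - y) ∨ W) ∧ d                             ≡⟨ ∧-distribʳ-∨ _ W d ⟩
    (((x ∧ d) - y) ∧ d) ∨ (W ∧ d)                       ≡⟨ cong₂ _∨_ below-d W∧d ⟩
    ((x ∧ d) - (y ∧ d)) ∨ ((b₁ ∧ W) ∨ (b₂ ∧ W))         ∎
    where
    open ≡-Reasoning
    W : Carrier
    W = x - (y ∨ d)
    below-d : ((x ∧ d) - y) ∧ d ≡ (x ∧ d) - (y ∧ d)
    below-d = trans (x≤y⇒x∧y≡x (≤-trans (x-y≤x _ y) (x∧y≤y x d))) (sym ([x∧z]-[y∧z]≡[x∧z]-y x y d))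
    W∧d : W ∧ d ≡ (b₁ ∧ W) ∨ (b₂ ∧ W)
    W∧d = trans (∧-comm W d) (∧-distribʳ-∨ b₁ b₂ W)

  embedding : Embedding L extension
  embedding = record
    { f = embed
    ; f-inj = λ x y embed-x≡embed-y → begin
        x                    ≡⟨ x≡[x∧y]∨[x-y] x d ⟩
        (x ∧ d) ∨ (x - d)    ≡⟨ cong₂ _∨_ (cong B embed-x≡embed-y) (cong A₁ embed-x≡embed-y) ⟩
        (y ∧ d) ∨ (y - d)    ≡⟨ sym (x≡[x∧y]∨[x-y] y d) ⟩
        y                    ∎
    ; f-𝟎 = Triple-≡ (𝟎-x≡𝟎 d) (𝟎-x≡𝟎 d) (x≤y⇒x∧y≡x (𝟎-least d))
    ; f-𝟏 = Triple-≡ (≪⇒𝟏-x≡𝟏 d≪a) (≪⇒𝟏-x≡𝟏 d≪a) (∧-identityˡ d)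
    ; f-∨ = λ x y → Triple-≡ (-distribʳ-∨ x y d) (-distribʳ-∨ x y d) (∧-distribʳ-∨ x y d)
    ; f-∧ = λ x y → Triple-≡ ([x∧y]-k≡[[x-k]∧[y-k]]-k x y d) ([x∧y]-k≡[[x-k]∧[y-k]]-k x y d)
                             (∧-distribʳ-∧ x y d)
    ; f-- = λ x y → Triple-≡ A-part A-part (trans ([x-y]∧d-split x y)
                      (cong (λ w → ((x ∧ d) - (y ∧ d)) ∨ ((b₁ ∧ w) ∨ (b₂ ∧ w))) (sym ([x-d]-[[y-d]∨d]≡x-[y∨d] x y))))
    }
    where
    open ≡-Reasoning
    A-part : ∀ {x y} → (x - y) - d ≡ (x - d) - ((y - d) ∨ d)
    A-part {x} {y} = trans (sym (x-[y∨z]≡[x-y]-z x y d)) (sym ([x-d]-[[y-d]∨d]≡x-[y∨d] x y))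

  a₁ a₂ : Triple
  a₁ = triple a 𝟎 b₁ (proj₁ d≪a) (𝟎-x≡𝟎 d) (trans (x-x≡𝟎 a) (sym (𝟎-x≡𝟎 a))) b₁≤d
              (x∧y≤x b₁ a) (≤-trans (≤-reflexive (∧-zeroʳ b₂)) (𝟎-least b₁))
  a₂ = triple 𝟎 a b₂ (𝟎-x≡𝟎 d) (proj₁ d≪a) (trans (𝟎-x≡𝟎 a) (sym (x-x≡𝟎 a))) b₂≤d
              (≤-trans (≤-reflexive (∧-zeroʳ b₁)) (𝟎-least b₂)) (x∧y≤x b₂ a)

  private
    [a-d]-[𝟎∨d]≡a : (a - d) - (𝟎 ∨ d) ≡ a
    [a-d]-[𝟎∨d]≡a = trans (cong ((a - d) -_) (𝟎-least d)) (trans (-idem a d) (proj₁ d≪a))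

    [a-d]-[a∨d]≡𝟎 : (a - d) - (a ∨ d) ≡ 𝟎
    [a-d]-[a∨d]≡𝟎 = x≤y⇒x-y≡𝟎 (≤-trans (x-y≤x a d) (x≤x∨y a d))

    [a∧d]-b≤b′ : ∀ {b b′} → d ≤ b ∨ b′ → (a ∧ d) - b ≤ b′
    [a∧d]-b≤b′ d≤b∨b′ = -least (≤-trans (x∧y≤y a d) d≤b∨b′)

    b∧a≡b : ∀ {b} → b ≤ d → b ∧ a ≡ b
    b∧a≡b b≤d = x≤y⇒x∧y≡x (≤-trans b≤d d≤a)

  embed-a∖a₂≡a₁ : embed a ∖ a₂ ≡ a₁
  embed-a∖a₂≡a₁ = Triple-≡ [a-d]-[𝟎∨d]≡a [a-d]-[a∨d]≡𝟎 (begin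
    ((a ∧ d) - b₂) ∨ ((b₁ ∧ ((a - d) - (𝟎 ∨ d))) ∨ (b₂ ∧ ((a - d) - (a ∨ d))))
      ≡⟨ cong₂ (λ x y → ((a ∧ d) - b₂) ∨ ((b₁ ∧ x) ∨ (b₂ ∧ y))) [a-d]-[𝟎∨d]≡a [a-d]-[a∨d]≡𝟎 ⟩
    ((a ∧ d) - b₂) ∨ ((b₁ ∧ a) ∨ (b₂ ∧ 𝟎))
      ≡⟨ cong (((a ∧ d) - b₂) ∨_) (trans (cong₂ _∨_ (b∧a≡b b₁≤d) (∧-zeroʳ b₂)) (∨-identityʳ b₁)) ⟩
    ((a ∧ d) - b₂) ∨ b₁
      ≡⟨ [a∧d]-b≤b′ (≤-reflexive (∨-comm b₁ b₂)) ⟩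
    b₁ ∎)
    where open ≡-Reasoning

  embed-a∖a₁≡a₂ : embed a ∖ a₁ ≡ a₂
  embed-a∖a₁≡a₂ = Triple-≡ [a-d]-[a∨d]≡𝟎 [a-d]-[𝟎∨d]≡a (begin
    ((a ∧ d) - b₁) ∨ ((b₁ ∧ ((a - d) - (a ∨ d))) ∨ (b₂ ∧ ((a - d) - (𝟎 ∨ d))))
      ≡⟨ cong₂ (λ x y → ((a ∧ d) - b₁) ∨ ((b₁ ∧ x) ∨ (b₂ ∧ y))) [a-d]-[a∨d]≡𝟎 [a-d]-[𝟎∨d]≡a ⟩
    ((a ∧ d) - b₁) ∨ ((b₁ ∧ 𝟎) ∨ (b₂ ∧ a))
      ≡⟨ cong (((a ∧ d) - b₁) ∨_) (trans (cong₂ _∨_ (∧-zeroʳ b₁) (b∧a≡b b₂≤d)) (𝟎-least b₂)) ⟩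
    ((a ∧ d) - b₁) ∨ b₂
      ≡⟨ [a∧d]-b≤b′ ≤-refl ⟩
    b₂ ∎)
    where open ≡-Reasoning

  embed-b₁⊔a₁≡a₁ : embed b₁ ⊔ a₁ ≡ a₁
  embed-b₁⊔a₁≡a₁ = Triple-≡ (trans (cong (_∨ a) (x≤y⇒x-y≡𝟎 b₁≤d)) (𝟎-least a))
                            (trans (cong (_∨ 𝟎) (x≤y⇒x-y≡𝟎 b₁≤d)) (∨-idem 𝟎)) (x∧y≤x b₁ d)

  embed-b₂⊔a₂≡a₂ : embed b₂ ⊔ a₂ ≡ a₂
  embed-b₂⊔a₂≡a₂ = Triple-≡ (trans (cong (_∨ 𝟎) (x≤y⇒x-y≡𝟎 b₂≤d)) (∨-idem 𝟎))
                            (trans (cong (_∨ a) (x≤y⇒x-y≡𝟎 b₂≤d)) (𝟎-least a)) (x∧y≤x b₂ d)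

  a₁⊓a₂≡embed[b₁∧b₂] : a₁ ⊓ a₂ ≡ embed (b₁ ∧ b₂)
  a₁⊓a₂≡embed[b₁∧b₂] = Triple-≡
    (trans (cong (_- d) (∧-zeroʳ a)) (trans (𝟎-x≡𝟎 d) (sym b₁∧b₂-d≡𝟎)))
    (trans (cong (_- d) (trans (∧-comm 𝟎 a) (∧-zeroʳ a))) (trans (𝟎-x≡𝟎 d) (sym b₁∧b₂-d≡𝟎)))
    (sym (x≤y⇒x∧y≡x (≤-trans (x∧y≤x b₁ b₂) b₁≤d)))
    where
    b₁∧b₂-d≡𝟎 : (b₁ ∧ b₂) - d ≡ 𝟎
    b₁∧b₂-d≡𝟎 = x≤y⇒x-y≡𝟎 (≤-trans (x∧y≤x b₁ b₂) b₁≤d)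

  module _ (v2 : InV2 L) (b₁∧b₂∧𝟏-[𝟏-a]≡𝟎 : (b₁ ∧ b₂) ∧ (𝟏 - (𝟏 - a)) ≡ 𝟎) where
    open InV2Properties v2

    s : Carrier
    s = 𝟏 - a

    b₁∧b₂≤s : b₁ ∧ b₂ ≤ s
    b₁∧b₂≤s = complement-≤ (𝟏-x-complements a) (≤-reflexive b₁∧b₂∧𝟏-[𝟏-a]≡𝟎)

    W V : Carrier → Carrier
    W A = 𝟏 - (A ∨ d)
    V A = 𝟏 - W A

    W-V-complements : ∀ A → Complements (W A) (V A)
    W-V-complements A = 𝟏-x-complements (A ∨ d)

    V-y≡[𝟏-y]∧V : ∀ A y → V A - y ≡ (𝟏 - y) ∧ V A
    V-y≡[𝟏-y]∧V A y = sym ([𝟏-y]∧k≡k-y (Complements-sym (W-V-complements A)) y)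

    V-d≡V : ∀ A → V A - d ≡ V A
    V-d≡V A = trans (V-y≡[𝟏-y]∧V A d) (trans (cong (_∧ V A) (≪⇒𝟏-x≡𝟏 d≪a)) (∧-identityˡ (V A)))

    V≤A : ∀ A → V A ≤ A
    V≤A A = subst (_≤ A) (V-d≡V A) (-least (≤-trans (𝟏-[𝟏-x]≤x (A ∨ d)) (≤-reflexive (∨-comm A d))))

    s∧W≡s∧W : ∀ {A A′} → A - a ≡ A′ - a → s ∧ W A ≡ s ∧ W A′
    s∧W≡s∧W {A} {A′} A-a≡A′-a = begin
      s ∧ W A          ≡⟨ [𝟏-x]∧[𝟏-y]≡𝟏-[x∨y] a (A ∨ d) ⟩
      𝟏 - (a ∨ A ∨ d)  ≡⟨ cong (𝟏 -_) a∨A∨d≡a∨A′∨d ⟩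
      𝟏 - (a ∨ A′ ∨ d) ≡⟨ sym ([𝟏-x]∧[𝟏-y]≡𝟏-[x∨y] a (A′ ∨ d)) ⟩
      s ∧ W A′         ∎
      where
      open ≡-Reasoning
      a∨A∨d≡a∨A′∨d : a ∨ A ∨ d ≡ a ∨ A′ ∨ d
      a∨A∨d≡a∨A′∨d = trans (sym (∨-assoc a A d))
        (trans (cong (_∨ d) (x-y≡z-y⇒y∨x≡y∨z A-a≡A′-a)) (∨-assoc a A′ d))

    s∧V≡s∧V : ∀ {A A′} → A - a ≡ A′ - a → s ∧ V A ≡ s ∧ V A′
    s∧V≡s∧V {A} {A′} A-a≡A′-a =
      ∧-complement-cong (W-V-complements A) (W-V-complements A′) (s∧W≡s∧W A-a≡A′-a)

    complement : Triple → Triple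
    complement D = triple (V (A₁ D)) (V (A₂ D)) ((b₁ ∧ V (A₁ D)) ∨ (b₂ ∧ V (A₂ D)))
      (V-d≡V (A₁ D)) (V-d≡V (A₂ D))
      (trans (V-y≡[𝟏-y]∧V (A₁ D) a) (trans (s∧V≡s∧V (agree D)) (sym (V-y≡[𝟏-y]∧V (A₂ D) a))))
      (∨-least (≤-trans (x∧y≤x _ _) b₁≤d) (≤-trans (x∧y≤x _ _) b₂≤d))
      (x≤x∨y _ _) (y≤x∨y _ _)

    -- Stated for (i , j) = (1 , 2) and (2 , 1) at once. Only the summand d - B needs work: below
    -- bᵢ ∧ V Aᵢ it lies under bⱼ, hence under b₁ ∧ b₂ ≤ s, where s ∧ V Aᵢ = s ∧ V Aⱼ moves it
    -- under bⱼ ∧ Aⱼ ≤ B.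
    B[𝟙∖D]∧bᵢ∧V≤𝟎 : ∀ {bᵢ bⱼ Aᵢ Aⱼ B} → d ≤ bᵢ ∨ bⱼ → bⱼ ∧ bᵢ ≤ s →
                   bᵢ ∧ Aᵢ ≤ B → bⱼ ∧ Aⱼ ≤ B → Aᵢ - a ≡ Aⱼ - a →
                   ((d - B) ∨ ((bᵢ ∧ W Aᵢ) ∨ (bⱼ ∧ W Aⱼ))) ∧ (bᵢ ∧ V Aᵢ) ≤ 𝟎
    B[𝟙∖D]∧bᵢ∧V≤𝟎 {bᵢ} {bⱼ} {Aᵢ} {Aⱼ} {B} d≤bᵢ∨bⱼ bⱼ∧bᵢ≤s bᵢ∧Aᵢ≤B bⱼ∧Aⱼ≤B Aᵢ-a≡Aⱼ-a =
      ≤-trans (≤-reflexive (∧-distribʳ-∨ _ _ _))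
        (∨-least [d-B]∧bᵢ∧Vᵢ≤𝟎
          (≤-trans (≤-reflexive (∧-distribʳ-∨ _ _ _)) (∨-least bᵢ∧Wᵢ∧bᵢ∧Vᵢ≤𝟎 bⱼ∧Wⱼ∧bᵢ∧Vᵢ≤𝟎)))
      where
      open ≤-Reasoning
      Vᵢ Wᵢ Y : Carrier
      Vᵢ = V Aᵢ
      Wᵢ = W Aᵢ
      Y = (bⱼ ∧ Vᵢ) - B
      s∧Vᵢ≤Vⱼ : s ∧ Vᵢ ≤ V Aⱼ
      s∧Vᵢ≤Vⱼ = ≤-trans (≤-reflexive (s∧V≡s∧V Aᵢ-a≡Aⱼ-a)) (x∧y≤y _ _)
      Wᵢ∧Vᵢ≡𝟎 : Wᵢ ∧ Vᵢ ≡ 𝟎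
      Wᵢ∧Vᵢ≡𝟎 = proj₁ (W-V-complements Aᵢ)
      [d-B]∧bᵢ∧Vᵢ≤𝟎 : (d - B) ∧ (bᵢ ∧ Vᵢ) ≤ 𝟎
      [d-B]∧bᵢ∧Vᵢ≤𝟎 = begin
        (d - B) ∧ (bᵢ ∧ Vᵢ)      ≤⟨ ∧-greatest (∧-monotonic ≤-refl (x∧y≤y _ _)) (≤-trans (x∧y≤y _ _) (x∧y≤x _ _)) ⟩
        ((d - B) ∧ Vᵢ) ∧ bᵢ      ≤⟨ ∧-monotonic ([x-y]∧k≤[x∧k]-y (Complements-sym (W-V-complements Aᵢ)) d B) ≤-refl ⟩
        ((d ∧ Vᵢ) - B) ∧ bᵢ      ≤⟨ ∧-greatest (≤-trans (x∧y≤x _ _) [d∧Vᵢ]-B≤Y)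
                                     (≤-trans (∧-monotonic [d∧Vᵢ]-B≤Y ≤-refl) Y∧bᵢ≤s) ⟩
        Y ∧ s                    ≤⟨ [x-y]∧k≤[x∧k]-y (𝟏-x-complements a) (bⱼ ∧ Vᵢ) B ⟩
        ((bⱼ ∧ Vᵢ) ∧ s) - B      ≡⟨ x≤y⇒x-y≡𝟎 (≤-trans (∧-greatest (≤-trans (x∧y≤x _ _) (x∧y≤x _ _))
                                     (≤-trans (∧-greatest (x∧y≤y _ _) (≤-trans (x∧y≤x _ _) (x∧y≤y _ _))) s∧Vᵢ≤Vⱼ))
                                     (≤-trans (∧-monotonic ≤-refl (V≤A Aⱼ)) bⱼ∧Aⱼ≤B)) ⟩
        𝟎                        ∎
        where
        Y∧bᵢ≤s : Y ∧ bᵢ ≤ s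
        Y∧bᵢ≤s = ≤-trans (∧-monotonic (≤-trans (x-y≤x _ B) (x∧y≤x bⱼ Vᵢ)) ≤-refl) bⱼ∧bᵢ≤s
        [d∧Vᵢ]-B≤Y : (d ∧ Vᵢ) - B ≤ Y
        [d∧Vᵢ]-B≤Y = -least (begin
          d ∧ Vᵢ                 ≤⟨ ∧-monotonic d≤bᵢ∨bⱼ ≤-refl ⟩
          (bᵢ ∨ bⱼ) ∧ Vᵢ         ≡⟨ ∧-distribʳ-∨ bᵢ bⱼ Vᵢ ⟩
          (bᵢ ∧ Vᵢ) ∨ (bⱼ ∧ Vᵢ)  ≤⟨ ∨-monotonic (≤-trans (∧-monotonic ≤-refl (V≤A Aᵢ)) bᵢ∧Aᵢ≤B) (x≤y∨[x-y] _ B) ⟩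
          B ∨ (B ∨ Y)            ≡⟨ trans (sym (∨-assoc B B Y)) (cong (_∨ Y) (∨-idem B)) ⟩
          B ∨ Y                  ∎)
      bᵢ∧Wᵢ∧bᵢ∧Vᵢ≤𝟎 : (bᵢ ∧ Wᵢ) ∧ (bᵢ ∧ Vᵢ) ≤ 𝟎
      bᵢ∧Wᵢ∧bᵢ∧Vᵢ≤𝟎 = ≤-trans (∧-monotonic (x∧y≤y _ _) (x∧y≤y _ _)) (≤-reflexive Wᵢ∧Vᵢ≡𝟎)
      bⱼ∧Wⱼ∧bᵢ∧Vᵢ≤𝟎 : (bⱼ ∧ W Aⱼ) ∧ (bᵢ ∧ Vᵢ) ≤ 𝟎
      bⱼ∧Wⱼ∧bᵢ∧Vᵢ≤𝟎 = begin
        (bⱼ ∧ W Aⱼ) ∧ (bᵢ ∧ Vᵢ)  ≤⟨ ∧-greatest (∧-greatest (≤-trans (∧-greatest (≤-trans (x∧y≤x _ _) (x∧y≤x _ _))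
                                                                            (≤-trans (x∧y≤y _ _) (x∧y≤x _ _))) bⱼ∧bᵢ≤s)
                                                          (≤-trans (x∧y≤x _ _) (x∧y≤y _ _)))
                                              (≤-trans (x∧y≤y _ _) (x∧y≤y _ _)) ⟩
        (s ∧ W Aⱼ) ∧ Vᵢ          ≡⟨ cong (_∧ Vᵢ) (sym (s∧W≡s∧W Aᵢ-a≡Aⱼ-a)) ⟩
        (s ∧ Wᵢ) ∧ Vᵢ            ≤⟨ ∧-monotonic (x∧y≤y _ _) ≤-refl ⟩
        Wᵢ ∧ Vᵢ                  ≡⟨ Wᵢ∧Vᵢ≡𝟎 ⟩
        𝟎                        ∎

    private module M = CoHeytingProperties extension

    𝟙∖D-complements : ∀ D → M.Complements (𝟙 ∖ D) (complement D)
    𝟙∖D-complements D = meet , join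
      where
      b₂∧b₁≤s : b₂ ∧ b₁ ≤ s
      b₂∧b₁≤s = ≤-trans (≤-reflexive (∧-comm b₂ b₁)) b₁∧b₂≤s
      meet : 𝟙 ∖ D ⊓ complement D ≡ 𝟘
      meet = Triple-≡
        (trans (cong (_- d) (proj₁ (W-V-complements (A₁ D)))) (𝟎-x≡𝟎 d))
        (trans (cong (_- d) (proj₁ (W-V-complements (A₂ D)))) (𝟎-x≡𝟎 d))
        (≤𝟎⇒≡𝟎 (≤-trans (≤-reflexive (∧-distrib-∨ _ _ _)) (∨-least
          (B[𝟙∖D]∧bᵢ∧V≤𝟎 ≤-refl b₂∧b₁≤s (b₁∧A₁≤B D) (b₂∧A₂≤B D) (agree D))
          (subst (λ t → ((d - B D) ∨ t) ∧ (b₂ ∧ V (A₂ D)) ≤ 𝟎) (∨-comm _ _)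
            (B[𝟙∖D]∧bᵢ∧V≤𝟎 (≤-reflexive (∨-comm b₁ b₂)) b₁∧b₂≤s (b₂∧A₂≤B D) (b₁∧A₁≤B D) (sym (agree D)))))))
      join : 𝟙 ∖ D ⊔ complement D ≡ 𝟙
      join = Triple-≡ (proj₂ (W-V-complements (A₁ D))) (proj₂ (W-V-complements (A₂ D)))
        (≤-antisym (∨-least (B≤d (𝟙 ∖ D)) (B≤d (complement D))) (∨-least
          (≤-trans (x≤[x∧k]∨[x∧k′] (W-V-complements (A₁ D)) b₁)
                   (∨-monotonic (≤-trans (x≤x∨y _ _) (y≤x∨y _ _)) (x≤x∨y _ _)))
          (≤-trans (x≤[x∧k]∨[x∧k′] (W-V-complements (A₂ D)) b₂)
                   (∨-monotonic (≤-trans (y≤x∨y _ _) (y≤x∨y _ _)) (y≤x∨y _ _)))))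

    extension-InV2 : InV2 extension
    extension-InV2 = M.InV2-if-𝟏-x-complemented λ D → complement D , 𝟙∖D-complements D

module _ {ℓ : Level} {P : Set ℓ} {n : ℕ} where
  infix 4 _`≉_ _`≤_ _`≪_
  _`≉_ _`≤_ _`≪_ : Term P n → Term P n → QF P n
  s `≉ t = `¬ (s `≈ t)
  s `≤ t = (s `∨ t) `≈ t
  t `≪ s = ((s `- t) `≈ s) `& (t `≤ s)

ExistentiallyClosedV2⇒D2 : ∀ {ℓ} (L : CoHeyting ℓ) → InV2 L → ExistentiallyClosedV2 L → D2 L
ExistentiallyClosedV2⇒D2 L v2 ec a c c≪a a≢𝟎 =
  let ρ , sat = ec extension (extension-InV2 v2) diagonal-embedding φ in-extension in ρ zero , sat
  where
  open CoHeyting L using (Carrier)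
  open D2Extension L c
  x : Term Carrier 1
  x = var zero
  φ : ExFormula Carrier
  φ = ∃[ 1 ] ((x `≉ `𝟎) `& ((par c `≪ x) `& (x `≪ par a)))
  in-extension : SatEx extension diagonal φ
  in-extension = (λ _ → gap c≪a) , (λ gap≡𝟘 → a≢𝟎 (cong Pair.hi gap≡𝟘)) ,
                 diagonal-c≪gap c≪a , gap≪diagonal-a c≪a

ExistentiallyClosedV2⇒S2 : ∀ {ℓ} (L : CoHeyting ℓ) → InV2 L → ExistentiallyClosedV2 L → S2 L
ExistentiallyClosedV2⇒S2 L v2 ec a b₁ b₂ d≪a a≢𝟎 b₁∧b₂∧𝟏-[𝟏-a]≡𝟎 =
  let ρ , sat = ec extension (extension-InV2 v2 b₁∧b₂∧𝟏-[𝟏-a]≡𝟎) embedding φ in-extension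
  in ρ zero , ρ (suc zero) , sat
  where
  open CoHeyting L using (Carrier; _∧_)
  open S2Extension L a b₁ b₂ d≪a
  x₁ x₂ : Term Carrier 2
  x₁ = var zero
  x₂ = var (suc zero)
  φ : ExFormula Carrier
  φ = ∃[ 2 ] ((x₁ `≉ `𝟎) `& ((x₂ `≉ `𝟎) `& (((par a `- x₂) `≈ x₁) `& ((par b₁ `≤ x₁) `&
        (((par a `- x₁) `≈ x₂) `& ((par b₂ `≤ x₂) `& ((x₁ `∧ x₂) `≈ par (b₁ ∧ b₂))))))))
  a₁a₂ : Fin 2 → Triple
  a₁a₂ zero = a₁
  a₁a₂ (suc _) = a₂
  in-extension : SatEx extension embed φ
  in-extension = a₁a₂ , (λ a₁≡𝟘 → a≢𝟎 (cong Triple.A₁ a₁≡𝟘)) , (λ a₂≡𝟘 → a≢𝟎 (cong Triple.A₂ a₂≡𝟘)) ,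
                 embed-a∖a₂≡a₁ , embed-b₁⊔a₁≡a₁ , embed-a∖a₁≡a₂ , embed-b₂⊔a₂≡a₂ , a₁⊓a₂≡embed[b₁∧b₂]

theorem5p4 : ∀ {ℓ} (L : CoHeyting ℓ) → InV2 L → ExistentiallyClosedV2 L →
    D2 L × S2 L
theorem5p4 L v2 ec = ExistentiallyClosedV2⇒D2 L v2 ec , ExistentiallyClosedV2⇒S2 L v2 ec
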